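{- $D_2^*(\mathbb{Z}_3^3)=10$; that is, every set of $10$ distinct elements of $\mathbb{Z}_3^3$ contains two disjoint nonempty subsets each summing to $0$, and there is a set of $9$ distinct elements of $\mathbb{Z}_3^3$ without two such disjoint subsets.
   Context: For a finite abelian group $G$ and integer $k\ge1$, $D_k^*(G)$ denotes the least integer $n$ such that every set of $n$ distinct elements of $G$ contains $k$ pairwise disjoint nonempty subsets each with sum $0$. -}

module Defs where

open import Data.Nat using (ℕ; zero; suc; _<_)
open import Data.Fin using (Fin)
import Data.Fin as F
open import Data.Product using (_×_; Σ; ∃; ∃-syntax; _,_)
open import Data.Vec using (Vec; lookup; zipWith; replicate; foldr; _∷_; [])
open import Data.Bool using (Bool; true; false; if_then_else_)
open import Data.Fin.Subset using (Subset; Nonempty; _∩_; ⊥; _∈_)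
open import Relation.Binary.PropositionalEquality using (_≡_; _≢_)
open import Relation.Nullary using (¬_)

_+₃_ : Fin 3 → Fin 3 → Fin 3
a +₃ b = F.fromℕ< (Data.Nat.DivMod.m%n<n (F.toℕ a Data.Nat.+ F.toℕ b) 3)
  where import Data.Nat.DivMod

Z3^ : ℕ → Set
Z3^ r = Vec (Fin 3) r

_⊕_ : ∀ {r} → Z3^ r → Z3^ r → Z3^ r
_⊕_ = zipWith _+₃_

𝟘 : ∀ {r} → Z3^ r
𝟘 = replicate _ F.zero

subsetSum : ∀ {r n} → (Fin n → Z3^ r) → Subset n → Z3^ r
subsetSum {n = zero}  x []      = 𝟘
subsetSum {n = suc n} x (b ∷ S) =
  (if b then x F.zero else 𝟘) ⊕ subsetSum (λ i → x (F.suc i)) S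

-- a set of n distinct elements of G, given as an injective indexing Fin n → G;
-- subsets of the set correspond to subsets of the index set Fin n.
Distinct : ∀ {r n} → (Fin n → Z3^ r) → Set
Distinct x = ∀ i j → x i ≡ x j → i ≡ j

HasDisjointZeroSums : ∀ {r n} → ℕ → (Fin n → Z3^ r) → Set
HasDisjointZeroSums {n = n} k x =
  Σ (Fin k → Subset n) λ S →
    (∀ j → Nonempty (S j)) ×
    (∀ j → subsetSum x (S j) ≡ 𝟘) ×
    (∀ j j' → j ≢ j' → S j ∩ S j' ≡ ⊥)

Prop-D* : ℕ → ℕ → ℕ → Set
Prop-D* r k n = (x : Fin n → Z3^ r) → Distinct x → HasDisjointZeroSums k x

D*≡ : ℕ → ℕ → ℕ → Set
D*≡ r k d = Prop-D* r k d × (∀ m → m < d → ¬ Prop-D* r k m)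

-- Among ten distinct elements of ℤ₃³ there is always a nonempty zero-sum subset of at most
-- three elements (such subsets are {0}, pairs {g, −g} and affine lines, and a cap in AG(3,3)
-- has at most nine points); the at least seven remaining elements contain another nonempty
-- zero-sum subset, because the Olson constant of ℤ₃³ is 7. Both facts are verified by an
-- exhaustive search over the subsets of ℤ₃³ taken in one fixed order. The search runs a
-- subset-sum dynamic programme whose state does not depend on the order in which elements are
-- added, so any set of distinct elements may be processed in that order, and it abandons a
-- branch as soon as a zero sum appears, which keeps it small. Conversely, the nine elements of
-- nineElements admit no two disjoint nonempty zero-sum subsets, as enumerating the pairs of
-- subsets shows.

module Submission where

open import Defs

import Algebra.Solver.CommutativeMonoid as CommutativeMonoidSolver
open import Data.Bool using (Bool; true; false; _∧_; _∨_; T)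
open import Data.Bool.Properties using (T-≡; T-∧; T-∨; ∨-commutativeMonoid)
import Data.Bool.Properties as Bool
open import Data.Empty using (⊥-elim)
open import Data.Fin using (Fin; zero; suc; #_)
import Data.Fin.Properties as Fin
open import Data.Fin.Subset using (Subset; inside; outside; ⊥; ⊤; ∁; _∩_; _⊆_; ∣_∣; Nonempty)
open import Data.Fin.Subset.Properties
  using (out⊆; s⊆s; ⊥⊆; ∣⊥∣≡0; ∣∁p∣≡n∸∣p∣; ∩-comm; Empty-unique; x∈p∩q⁻; x∈p⇒x∉∁p;
         nonempty?; anySubset?)
open import Data.List using (List; []; _∷_; length; foldr; filter; allFin; cartesianProductWith)
open import Data.List.Membership.Propositional using () renaming (_∈_ to _∈ˡ_)
open import Data.List.Membership.Propositional.Properties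
  using (∈-filter⁺; ∈-filter⁻; ∈-allFin; ∈-cartesianProductWith⁺)
open import Data.List.Membership.Propositional.Properties.WithK using (unique∧set⇒bag)
open import Data.List.Relation.Binary.BagAndSetEquality using (∼bag⇒↭)
open import Data.List.Relation.Binary.Permutation.Propositional using (_↭_; refl; prep; swap; trans)
open import Data.List.Relation.Binary.Permutation.Propositional.Properties using (↭-length)
open import Data.List.Relation.Binary.Sublist.Propositional using (_∷ʳ_; _∷_) renaming (_⊆_ to _⊑_)
open import Data.List.Relation.Binary.Sublist.Propositional.Properties using (filter-⊆; length-mono-≤)
import Data.List.Relation.Unary.All as All
open import Data.List.Relation.Unary.Any using (here; there)
open import Data.List.Relation.Unary.Unique.Propositional using (Unique)
open import Data.List.Relation.Unary.AllPairs using ([]; _∷_)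
open import Data.List.Relation.Unary.Unique.Propositional.Properties
  using (filter⁺; allFin⁺; cartesianProductWith⁺)
open import Data.Nat using (ℕ; zero; suc; _+_; _≤_; _<_; _≤′_; ≤′-reflexive; ≤′-step; z≤n; s≤s; _<ᵇ_)
open import Data.Nat.Properties
  using (≤-refl; ≤-trans; ≤-pred; <⇒≤; <⇒≱; <ᵇ⇒<; ≤⇒≤′; ∸-monoʳ-≤; m<m+n; +-suc)
open import Data.Product using (_×_; _,_; proj₁; proj₂; ∃-syntax)
import Data.Product as Product
open import Data.Sum using (_⊎_; inj₁; inj₂)
open import Data.Vec using (Vec; []; _∷_; here; there; lookup; tabulate; zipWith; replicate)
open import Data.Vec.Properties using (lookup∘tabulate; tabulate-cong; ∷-injective; ≡-dec)
open import Function using (_∘_; id)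
open import Function.Bundles using (Equivalence; _⇔_; mk⇔)
open import Relation.Binary.Definitions using (DecidableEquality)
open import Relation.Binary.PropositionalEquality
  using (_≡_; _≢_; refl; sym; cong; cong₂; subst; module ≡-Reasoning)
  renaming (trans to ≡-trans)
open import Relation.Nullary using (¬_; Dec; contradiction)
open import Relation.Nullary.Decidable using (from-yes; from-no; _×-dec_; _→-dec_)

-- Tabulated rather than derived from _+₃_, since the searches below evaluate it very often.
_-₃_ : Fin 3 → Fin 3 → Fin 3
zero           -₃ zero           = zero
zero           -₃ suc zero       = suc (suc zero)
zero           -₃ suc (suc zero) = suc zero
suc zero       -₃ zero           = suc zero
suc zero       -₃ suc zero       = zero
suc zero       -₃ suc (suc zero) = suc (suc zero)
suc (suc zero) -₃ zero           = suc (suc zero)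
suc (suc zero) -₃ suc zero       = suc zero
suc (suc zero) -₃ suc (suc zero) = zero

a+₃[c-₃a]≡c : ∀ a c → a +₃ (c -₃ a) ≡ c
a+₃[c-₃a]≡c = from-yes (Fin.all? λ a → Fin.all? λ c → a +₃ (c -₃ a) Fin.≟ c)

[c-₃a]-₃b≡[c-₃b]-₃a : ∀ c a b → (c -₃ a) -₃ b ≡ (c -₃ b) -₃ a
[c-₃a]-₃b≡[c-₃b]-₃a =
  from-yes (Fin.all? λ c → Fin.all? λ a → Fin.all? λ b → (c -₃ a) -₃ b Fin.≟ (c -₃ b) -₃ a)

+₃-identityˡ : ∀ a → zero +₃ a ≡ a
+₃-identityˡ = from-yes (Fin.all? λ a → zero +₃ a Fin.≟ a)

_⊖_ : ∀ {r} → Z3^ r → Z3^ r → Z3^ r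
_⊖_ = zipWith _-₃_

u⊕[v⊖u]≡v : ∀ {r} (u v : Z3^ r) → u ⊕ (v ⊖ u) ≡ v
u⊕[v⊖u]≡v []      []      = refl
u⊕[v⊖u]≡v (a ∷ u) (c ∷ v) = cong₂ _∷_ (a+₃[c-₃a]≡c a c) (u⊕[v⊖u]≡v u v)

[w⊖u]⊖v≡[w⊖v]⊖u : ∀ {r} (w u v : Z3^ r) → (w ⊖ u) ⊖ v ≡ (w ⊖ v) ⊖ u
[w⊖u]⊖v≡[w⊖v]⊖u []      []      []      = refl
[w⊖u]⊖v≡[w⊖v]⊖u (c ∷ w) (a ∷ u) (b ∷ v) =
  cong₂ _∷_ ([c-₃a]-₃b≡[c-₃b]-₃a c a b) ([w⊖u]⊖v≡[w⊖v]⊖u w u v)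

⊕-identityˡ : ∀ {r} (v : Z3^ r) → 𝟘 ⊕ v ≡ v
⊕-identityˡ []      = refl
⊕-identityˡ (a ∷ v) = cong₂ _∷_ (+₃-identityˡ a) (⊕-identityˡ v)

_≟ᵛ_ : ∀ {r} → DecidableEquality (Z3^ r)
_≟ᵛ_ = ≡-dec Fin._≟_

isZero : ∀ {r} → Z3^ r → Bool
isZero []          = true
isZero (zero  ∷ v) = isZero v
isZero (suc _ ∷ v) = false

isZero-sound : ∀ {r} (v : Z3^ r) → T (isZero v) → v ≡ 𝟘
isZero-sound []         _ = refl
isZero-sound (zero ∷ v) h = cong (zero ∷_) (isZero-sound v h)

vectors : ∀ r → List (Z3^ r)
vectors zero    = [] ∷ []
vectors (suc r) = cartesianProductWith _∷_ (allFin 3) (vectors r)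

∈-vectors : ∀ {r} (v : Z3^ r) → v ∈ˡ vectors r
∈-vectors []      = here refl
∈-vectors (a ∷ v) = ∈-cartesianProductWith⁺ _∷_ (∈-allFin a) (∈-vectors v)

vectors-unique : ∀ r → Unique (vectors r)
vectors-unique zero    = All.[] ∷ []
vectors-unique (suc r) = cartesianProductWith⁺ _∷_ ∷-injective (allFin⁺ 3) (vectors-unique r)

subsetSum-⊥ : ∀ {r n} (x : Fin n → Z3^ r) → subsetSum x ⊥ ≡ 𝟘
subsetSum-⊥ {n = zero}  x = refl
subsetSum-⊥ {n = suc n} x = ≡-trans (⊕-identityˡ _) (subsetSum-⊥ (x ∘ suc))

∣p∣>0⇒Nonempty : ∀ {n} (p : Subset n) → 0 < ∣ p ∣ → Nonempty p
∣p∣>0⇒Nonempty (inside  ∷ p) _ = zero , here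
∣p∣>0⇒Nonempty (outside ∷ p) h = Product.map suc there (∣p∣>0⇒Nonempty p h)

⊆∁⇒∩≡⊥ : ∀ {n} {p q : Subset n} → q ⊆ ∁ p → p ∩ q ≡ ⊥
⊆∁⇒∩≡⊥ {p = p} {q} q⊆∁p = Empty-unique λ (i , i∈p∩q) →
  let i∈p , i∈q = x∈p∩q⁻ p q i∈p∩q in x∈p⇒x∉∁p i∈p (q⊆∁p i∈q)

module _ where
  open CommutativeMonoidSolver ∨-commutativeMonoid using (solve; _⊜_) renaming (_⊕_ to _∙_)

  [p∨q]∨s≡[p∨s]∨q : ∀ p q s → (p ∨ q) ∨ s ≡ (p ∨ s) ∨ q
  [p∨q]∨s≡[p∨s]∨q = solve 3 (λ p q s → (p ∙ q) ∙ s ⊜ (p ∙ s) ∙ q) refl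

  ∨-interchange : ∀ p q s v → (p ∨ q) ∨ (s ∨ v) ≡ (p ∨ s) ∨ (q ∨ v)
  ∨-interchange = solve 4 (λ p q s v → (p ∙ q) ∙ (s ∙ v) ⊜ (p ∙ s) ∙ (q ∙ v)) refl

  [p∨[q∨s]]∨[[v∨w]∨y]≡[p∨[v∨y]]∨[[q∨w]∨s] : ∀ p q s v w y →
    (p ∨ (q ∨ s)) ∨ ((v ∨ w) ∨ y) ≡ (p ∨ (v ∨ y)) ∨ ((q ∨ w) ∨ s)
  [p∨[q∨s]]∨[[v∨w]∨y]≡[p∨[v∨y]]∨[[q∨w]∨s] = solve 6 (λ p q s v w y →
    (p ∙ (q ∙ s)) ∙ ((v ∙ w) ∙ y) ⊜ (p ∙ (v ∙ y)) ∙ ((q ∙ w) ∙ s)) refl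

-- A subset of ℤ₃^r as a ternary trie of Booleans, so that each state of the search is memoised.
Table : ℕ → Set
Table zero    = Bool
Table (suc r) = Vec (Table r) 3

lookupᵀ : ∀ {r} → Table r → Z3^ r → Bool
lookupᵀ {zero}  b []      = b
lookupᵀ {suc r} t (a ∷ v) = lookupᵀ (lookup t a) v

tabulateᵀ : ∀ {r} → (Z3^ r → Bool) → Table r
tabulateᵀ {zero}  f = f []
tabulateᵀ {suc r} f = tabulate λ a → tabulateᵀ (f ∘ (a ∷_))

lookupᵀ∘tabulateᵀ : ∀ {r} (f : Z3^ r → Bool) v → lookupᵀ (tabulateᵀ f) v ≡ f v
lookupᵀ∘tabulateᵀ {zero}  f []      = refl
lookupᵀ∘tabulateᵀ {suc r} f (a ∷ v) =
  ≡-trans (cong (λ t → lookupᵀ t v) (lookup∘tabulate (λ a → tabulateᵀ (f ∘ (a ∷_))) a)) (lookupᵀ∘tabulateᵀ (f ∘ (a ∷_)) v)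

tabulateᵀ-cong : ∀ {r} {f g : Z3^ r → Bool} → (∀ v → f v ≡ g v) → tabulateᵀ f ≡ tabulateᵀ g
tabulateᵀ-cong {zero}  f≗g = f≗g []
tabulateᵀ-cong {suc r} f≗g = tabulate-cong λ a → tabulateᵀ-cong (f≗g ∘ (a ∷_))

emptyᵀ : ∀ {r} → Table r
emptyᵀ = tabulateᵀ λ _ → false

grow : ∀ {r} → Z3^ r → (Z3^ r → Bool) → Table r → Table r
grow a u t = tabulateᵀ λ g → lookupᵀ t g ∨ u (g ⊖ a)

module _ {r} (a : Z3^ r) where

  lookupᵀ-grow : ∀ u t g → lookupᵀ (grow a u t) g ≡ lookupᵀ t g ∨ u (g ⊖ a)
  lookupᵀ-grow u t = lookupᵀ∘tabulateᵀ _

  grow-inflationary : ∀ u t g → T (lookupᵀ t g) → T (lookupᵀ (grow a u t) g)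
  grow-inflationary u t g tg =
    subst T (sym (lookupᵀ-grow u t g)) (Equivalence.from T-∨ (inj₁ tg))

module _ {r} (a b : Z3^ r) where
  open ≡-Reasoning

  grow-comm : ∀ u t → grow a u (grow b u t) ≡ grow b u (grow a u t)
  grow-comm u t = tabulateᵀ-cong λ g → begin
    lookupᵀ (grow b u t) g ∨ u (g ⊖ a)     ≡⟨ cong (_∨ u (g ⊖ a)) (lookupᵀ-grow b u t g) ⟩
    (lookupᵀ t g ∨ u (g ⊖ b)) ∨ u (g ⊖ a)  ≡⟨ [p∨q]∨s≡[p∨s]∨q (lookupᵀ t g) (u (g ⊖ b)) (u (g ⊖ a)) ⟩
    (lookupᵀ t g ∨ u (g ⊖ a)) ∨ u (g ⊖ b)  ≡⟨ cong (_∨ u (g ⊖ b)) (sym (lookupᵀ-grow a u t g)) ⟩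
    lookupᵀ (grow a u t) g ∨ u (g ⊖ b)     ∎

  grow-grow-comm : ∀ w t t′ →
    grow a (lookupᵀ (grow b w t)) (grow b (lookupᵀ t) t′) ≡
    grow b (lookupᵀ (grow a w t)) (grow a (lookupᵀ t) t′)
  grow-grow-comm w t t′ = tabulateᵀ-cong λ g → begin
    lookupᵀ (grow b (lookupᵀ t) t′) g ∨ lookupᵀ (grow b w t) (g ⊖ a)
      ≡⟨ cong₂ _∨_ (lookupᵀ-grow b (lookupᵀ t) t′ g) (lookupᵀ-grow b w t (g ⊖ a)) ⟩
    (lookupᵀ t′ g ∨ lookupᵀ t (g ⊖ b)) ∨ (lookupᵀ t (g ⊖ a) ∨ w ((g ⊖ a) ⊖ b))
      ≡⟨ cong (λ h → (lookupᵀ t′ g ∨ lookupᵀ t (g ⊖ b)) ∨ (lookupᵀ t (g ⊖ a) ∨ w h))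
              ([w⊖u]⊖v≡[w⊖v]⊖u g a b) ⟩
    (lookupᵀ t′ g ∨ lookupᵀ t (g ⊖ b)) ∨ (lookupᵀ t (g ⊖ a) ∨ w ((g ⊖ b) ⊖ a))
      ≡⟨ ∨-interchange (lookupᵀ t′ g) _ _ _ ⟩
    (lookupᵀ t′ g ∨ lookupᵀ t (g ⊖ a)) ∨ (lookupᵀ t (g ⊖ b) ∨ w ((g ⊖ b) ⊖ a))
      ≡⟨ sym (cong₂ _∨_ (lookupᵀ-grow a (lookupᵀ t) t′ g) (lookupᵀ-grow a w t (g ⊖ b))) ⟩
    lookupᵀ (grow a (lookupᵀ t) t′) g ∨ lookupᵀ (grow a w t) (g ⊖ b) ∎

with𝟘 : ∀ {r} → Table r → Z3^ r → Bool
with𝟘 s g = lookupᵀ s g ∨ isZero g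

addToSums : ∀ {r} → Z3^ r → Table r → Table r
addToSums a s = grow a (with𝟘 s) s

addToSums-comm : ∀ {r} (a b : Z3^ r) s → addToSums a (addToSums b s) ≡ addToSums b (addToSums a s)
addToSums-comm {r} a b s = tabulateᵀ-cong λ g → begin
  S′ b g ∨ with𝟘 (addToSums b s) (g ⊖ a)
    ≡⟨ cong₂ (λ p q → p ∨ (q ∨ isZero (g ⊖ a))) (lookupᵀ-grow b Z s g) (lookupᵀ-grow b Z s (g ⊖ a)) ⟩
  (S g ∨ Z (g ⊖ b)) ∨ ((S (g ⊖ a) ∨ Z ((g ⊖ a) ⊖ b)) ∨ isZero (g ⊖ a))
    ≡⟨ cong (λ h → (S g ∨ Z (g ⊖ b)) ∨ ((S (g ⊖ a) ∨ Z h) ∨ isZero (g ⊖ a))) ([w⊖u]⊖v≡[w⊖v]⊖u g a b) ⟩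
  (S g ∨ Z (g ⊖ b)) ∨ ((S (g ⊖ a) ∨ Z ((g ⊖ b) ⊖ a)) ∨ isZero (g ⊖ a))
    ≡⟨ [p∨[q∨s]]∨[[v∨w]∨y]≡[p∨[v∨y]]∨[[q∨w]∨s]
         (S g) (S (g ⊖ b)) (isZero (g ⊖ b)) (S (g ⊖ a)) (Z ((g ⊖ b) ⊖ a)) (isZero (g ⊖ a)) ⟩
  (S g ∨ Z (g ⊖ a)) ∨ ((S (g ⊖ b) ∨ Z ((g ⊖ b) ⊖ a)) ∨ isZero (g ⊖ b))
    ≡⟨ sym (cong₂ (λ p q → p ∨ (q ∨ isZero (g ⊖ b))) (lookupᵀ-grow a Z s g) (lookupᵀ-grow a Z s (g ⊖ b))) ⟩
  S′ a g ∨ with𝟘 (addToSums a s) (g ⊖ b) ∎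
  where
  open ≡-Reasoning
  S Z : Z3^ r → Bool
  S = lookupᵀ s
  Z = with𝟘 s
  S′ : Z3^ r → Z3^ r → Bool
  S′ c = lookupᵀ (addToSums c s)

addToSums-𝟘 : ∀ {r} (a : Z3^ r) s → T (lookupᵀ s 𝟘) → T (lookupᵀ (addToSums a s) 𝟘)
addToSums-𝟘 a s = grow-inflationary a (with𝟘 s) s 𝟘

growLevels : ∀ {r k} → Z3^ r → (Z3^ r → Bool) → Vec (Table r) k → Vec (Table r) k
growLevels a u []       = []
growLevels a u (t ∷ ts) = grow a u t ∷ growLevels a (lookupᵀ t) ts

addToSizedSums : ∀ {r k} → Z3^ r → Vec (Table r) k → Vec (Table r) k
addToSizedSums a = growLevels a isZero

module _ {r} (a b : Z3^ r) where

  growLevels-grow-comm : ∀ {k} w t (ts : Vec (Table r) k) →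
    growLevels a (lookupᵀ (grow b w t)) (growLevels b (lookupᵀ t) ts) ≡
    growLevels b (lookupᵀ (grow a w t)) (growLevels a (lookupᵀ t) ts)
  growLevels-grow-comm w t []        = refl
  growLevels-grow-comm w t (t′ ∷ ts) =
    cong₂ _∷_ (grow-grow-comm a b w t t′) (growLevels-grow-comm (lookupᵀ t) t′ ts)

  growLevels-comm : ∀ {k} u (ts : Vec (Table r) k) →
    growLevels a u (growLevels b u ts) ≡ growLevels b u (growLevels a u ts)
  growLevels-comm u []       = refl
  growLevels-comm u (t ∷ ts) = cong₂ _∷_ (grow-comm a b u t) (growLevels-grow-comm u t ts)

someContain𝟘 : ∀ {r k} → Vec (Table r) k → Bool
someContain𝟘 []       = false
someContain𝟘 (t ∷ ts) = lookupᵀ t 𝟘 ∨ someContain𝟘 ts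

growLevels-someContain𝟘 : ∀ {r k} (a : Z3^ r) u (ts : Vec (Table r) k) →
  T (someContain𝟘 ts) → T (someContain𝟘 (growLevels a u ts))
growLevels-someContain𝟘 a u (t ∷ ts) h with Equivalence.to T-∨ h
... | inj₁ t𝟘  = Equivalence.from T-∨ (inj₁ (grow-inflationary a u t 𝟘 t𝟘))
... | inj₂ ts𝟘 = Equivalence.from T-∨ (inj₂ (growLevels-someContain𝟘 a (lookupᵀ t) ts ts𝟘))

record Accumulator (A St : Set) : Set where
  field
    step      : A → St → St
    good      : St → Bool
    step-comm : ∀ a b s → step a (step b s) ≡ step b (step a s)
    good-step : ∀ a s → T (good s) → T (good (step a s))

module SubsetSearch {A St : Set} (accumulator : Accumulator A St) where

  open Accumulator accumulator

  run : St → List A → St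
  run s = foldr step s

  run-step : ∀ a s l → run (step a s) l ≡ step a (run s l)
  run-step a s []      = refl
  run-step a s (b ∷ l) = ≡-trans (cong (step b) (run-step a s l)) (step-comm b a (run s l))

  run-good : ∀ s l → T (good s) → T (good (run s l))
  run-good s []      h = h
  run-good s (a ∷ l) h = good-step a (run s l) (run-good s l h)

  run-↭ : ∀ s {l l′} → l ↭ l′ → run s l ≡ run s l′
  run-↭ s refl         = refl
  run-↭ s (prep a p)   = cong (step a) (run-↭ s p)
  run-↭ s (swap a b p) = ≡-trans (cong (step a ∘ step b) (run-↭ s p)) (step-comm a b _)
  run-↭ s (trans p q)  = ≡-trans (run-↭ s p) (run-↭ s q)

  mutual
    check : St → List A → ℕ → Bool
    check s rest k = good s ∨ ((length rest <ᵇ k) ∨ branch s rest k)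

    branch : St → List A → ℕ → Bool
    branch s (a ∷ rest) (suc k) = check (step a s) rest k ∧ check s rest (suc k)
    branch s _          _       = false

  mutual
    check-sound : ∀ s rest k → T (check s rest k) →
                  ∀ {sub} → sub ⊑ rest → k ≤ length sub → T (good (run s sub))
    check-sound s rest k h {sub} sub⊑rest k≤∣sub∣ with Equivalence.to T-∨ h
    ... | inj₁ good-s = run-good s sub good-s
    ... | inj₂ h′ with Equivalence.to T-∨ h′
    ...   | inj₁ ∣rest∣<k =
      contradiction (≤-trans k≤∣sub∣ (length-mono-≤ sub⊑rest)) (<⇒≱ (<ᵇ⇒< _ k ∣rest∣<k))
    ...   | inj₂ h″ = branch-sound s rest k h″ sub⊑rest k≤∣sub∣

    branch-sound : ∀ s rest k → T (branch s rest k) →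
                   ∀ {sub} → sub ⊑ rest → k ≤ length sub → T (good (run s sub))
    branch-sound s (a ∷ rest) (suc k) h (.a ∷ʳ sub⊑rest) k≤∣sub∣ =
      check-sound s rest (suc k) (proj₂ (Equivalence.to T-∧ h)) sub⊑rest k≤∣sub∣
    branch-sound s (a ∷ rest) (suc k) h {.a ∷ sub} (refl ∷ sub⊑rest) (s≤s k≤∣sub∣) =
      subst (T ∘ good) (run-step a s sub)
        (check-sound (step a s) rest k (proj₁ (Equivalence.to T-∧ h)) sub⊑rest k≤∣sub∣)

  check-sound-↭ : ∀ s rest k → check s rest k ≡ true →
                  ∀ {l l′} → l ↭ l′ → l′ ⊑ rest → k ≤ length l → T (good (run s l))
  check-sound-↭ s rest k h l↭l′ l′⊑rest k≤∣l∣ =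
    subst (T ∘ good) (sym (run-↭ s l↭l′))
      (check-sound s rest k (Equivalence.from T-≡ h) l′⊑rest (subst (k ≤_) (↭-length l↭l′) k≤∣l∣))

module Canonical {A : Set} (_≟_ : DecidableEquality A) (universe : List A)
  (∈-universe : ∀ a → a ∈ˡ universe) (universe-unique : Unique universe) where

  open import Data.List.Membership.DecPropositional _≟_ using (_∈?_)

  canonical : List A → List A
  canonical l = filter (_∈? l) universe

  canonical⊑universe : ∀ l → canonical l ⊑ universe
  canonical⊑universe l = filter-⊆ (_∈? l) universe

  ↭-canonical : ∀ {l} → Unique l → l ↭ canonical l
  ↭-canonical {l} l-unique = ∼bag⇒↭ (unique∧set⇒bag l-unique (filter⁺ (_∈? l) universe-unique)
    (mk⇔ (∈-filter⁺ (_∈? l) (∈-universe _)) (λ m → proj₂ (∈-filter⁻ (_∈? l) {xs = universe} m))))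

module _ {r : ℕ} where

  elements : ∀ {n} → (Fin n → Z3^ r) → Subset n → List (Z3^ r)
  elements {zero}  x []            = []
  elements {suc n} x (inside ∷ U)  = x zero ∷ elements (x ∘ suc) U
  elements {suc n} x (outside ∷ U) = elements (x ∘ suc) U

  length-elements : ∀ {n} (x : Fin n → Z3^ r) U → length (elements x U) ≡ ∣ U ∣
  length-elements {zero}  x []            = refl
  length-elements {suc n} x (inside ∷ U)  = cong suc (length-elements (x ∘ suc) U)
  length-elements {suc n} x (outside ∷ U) = length-elements (x ∘ suc) U

  ∈-elements⁻ : ∀ {n} (x : Fin n → Z3^ r) U {g} → g ∈ˡ elements x U → ∃[ i ] x i ≡ g
  ∈-elements⁻ {suc n} x (inside ∷ U)  (here g≡x₀) = zero , sym g≡x₀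
  ∈-elements⁻ {suc n} x (inside ∷ U)  (there g∈) = Product.map suc id (∈-elements⁻ (x ∘ suc) U g∈)
  ∈-elements⁻ {suc n} x (outside ∷ U) g∈         = Product.map suc id (∈-elements⁻ (x ∘ suc) U g∈)

  distinct-suc : ∀ {n} {x : Fin (suc n) → Z3^ r} → Distinct x → Distinct (x ∘ suc)
  distinct-suc distinct i j xi≡xj = Fin.suc-injective (distinct (suc i) (suc j) xi≡xj)

  elements-unique : ∀ {n} {x : Fin n → Z3^ r} → Distinct x → ∀ U → Unique (elements x U)
  elements-unique {zero}          distinct []            = []
  elements-unique {suc n} {x = x} distinct (inside ∷ U)  =
    All.tabulate x₀∉ ∷ elements-unique (distinct-suc distinct) U
    where
    x₀∉ : ∀ {g} → g ∈ˡ elements (x ∘ suc) U → x zero ≢ g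
    x₀∉ g∈ x₀≡g with ∈-elements⁻ (x ∘ suc) U g∈
    ... | i , xi≡g with distinct zero (suc i) (≡-trans x₀≡g (sym xi≡g))
    ... | ()
  elements-unique {suc n}         distinct (outside ∷ U) = elements-unique (distinct-suc distinct) U

  record Realised {n} (x : Fin n → Z3^ r) (U : Subset n) (Size : ℕ → Set) (f : Z3^ r → Bool) : Set where
    field
      realise : ∀ g → T (f g) → ∃[ S ] (S ⊆ U × Size ∣ S ∣ × subsetSum x S ≡ g)

  open Realised public

  module _ {n} {x : Fin (suc n) → Z3^ r} {U : Subset n} {Size : ℕ → Set} where

    realised-outside : ∀ {b f} → Realised (x ∘ suc) U Size f → Realised x (b ∷ U) Size f
    realised-outside ρ .realise g fg with ρ .realise g fg
    ... | S , S⊆U , size , sum≡g = outside ∷ S , out⊆ S⊆U , size , ≡-trans (⊕-identityˡ _) sum≡g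

    realised-grow : ∀ {Size′ : ℕ → Set} {u t} →
      Realised (x ∘ suc) U Size (lookupᵀ t) → Realised (x ∘ suc) U Size′ u →
      (∀ {m} → Size′ m → Size (suc m)) → Realised x (inside ∷ U) Size (lookupᵀ (grow (x zero) u t))
    realised-grow {u = u} {t} ρt ρu grows .realise g h
      with Equivalence.to T-∨ (subst T (lookupᵀ-grow (x zero) u t g) h)
    ... | inj₁ tg = realised-outside ρt .realise g tg
    ... | inj₂ ug with ρu .realise (g ⊖ x zero) ug
    ...   | S , S⊆U , size , sum≡g-x₀ =
      inside ∷ S , s⊆s S⊆U , grows size ,
      ≡-trans (cong (x zero ⊕_) sum≡g-x₀) (u⊕[v⊖u]≡v (x zero) g)

  module _ {n} {x : Fin n → Z3^ r} {U : Subset n} where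

    realised-∨ : ∀ {Size Size′ f f′} → Realised x U Size f → Realised x U Size′ f′ →
                 Realised x U (λ m → Size m ⊎ Size′ m) (λ g → f g ∨ f′ g)
    realised-∨ ρ ρ′ .realise g h with Equivalence.to T-∨ h
    ... | inj₁ fg  = Product.map₂ (Product.map₂ (Product.map₁ inj₁)) (ρ .realise g fg)
    ... | inj₂ f′g = Product.map₂ (Product.map₂ (Product.map₁ inj₂)) (ρ′ .realise g f′g)

    realised-isZero : Realised x U (_≡ 0) isZero
    realised-isZero .realise g g≡𝟘 =
      ⊥ , ⊥⊆ , ∣⊥∣≡0 n , ≡-trans (subsetSum-⊥ x) (sym (isZero-sound g g≡𝟘))

    realised-emptyᵀ : ∀ {Size} → Realised x U Size (lookupᵀ emptyᵀ)
    realised-emptyᵀ .realise g h = ⊥-elim (subst T (lookupᵀ∘tabulateᵀ _ g) h)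

  sumsOf : ∀ {n} → (Fin n → Z3^ r) → Subset n → Table r
  sumsOf x U = foldr addToSums emptyᵀ (elements x U)

  realised-sumsOf : ∀ {n} (x : Fin n → Z3^ r) U → Realised x U (0 <_) (lookupᵀ (sumsOf x U))
  realised-sumsOf {zero}  x []            = realised-emptyᵀ
  realised-sumsOf {suc n} x (outside ∷ U) = realised-outside (realised-sumsOf (x ∘ suc) U)
  realised-sumsOf {suc n} x (inside ∷ U)  =
    realised-grow realised-tail (realised-∨ realised-tail realised-isZero) λ _ → s≤s z≤n
    where
    realised-tail : Realised (x ∘ suc) U (0 <_) (lookupᵀ (sumsOf (x ∘ suc) U))
    realised-tail = realised-sumsOf (x ∘ suc) U

  data RealisedLevels {n} (x : Fin n → Z3^ r) (U : Subset n) (m : ℕ) : ∀ {k} → Vec (Table r) k → Set where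
    []  : RealisedLevels x U m []
    _∷_ : ∀ {k t} {ts : Vec (Table r) k} →
          Realised x U (_≡ m) (lookupᵀ t) → RealisedLevels x U (suc m) ts → RealisedLevels x U m (t ∷ ts)

  module _ {n} {x : Fin (suc n) → Z3^ r} {U : Subset n} where

    realisedLevels-outside : ∀ {b m k} {ts : Vec (Table r) k} →
      RealisedLevels (x ∘ suc) U m ts → RealisedLevels x (b ∷ U) m ts
    realisedLevels-outside []                  = []
    realisedLevels-outside (ρ ∷ levels) = realised-outside ρ ∷ realisedLevels-outside levels

    realisedLevels-grow : ∀ {m k u} {ts : Vec (Table r) k} →
      Realised (x ∘ suc) U (_≡ m) u → RealisedLevels (x ∘ suc) U (suc m) ts →
      RealisedLevels x (inside ∷ U) (suc m) (growLevels (x zero) u ts)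
    realisedLevels-grow ρu []            = []
    realisedLevels-grow ρu (ρ ∷ levels) = realised-grow ρ ρu (cong suc) ∷ realisedLevels-grow ρ levels

  realisedLevels-emptyᵀ : ∀ {n} {x : Fin n → Z3^ r} {U m} k → RealisedLevels x U m (replicate k emptyᵀ)
  realisedLevels-emptyᵀ zero    = []
  realisedLevels-emptyᵀ (suc k) = realised-emptyᵀ ∷ realisedLevels-emptyᵀ k

  sizedSumsOf : ∀ {n} k → (Fin n → Z3^ r) → Subset n → Vec (Table r) k
  sizedSumsOf k x U = foldr addToSizedSums (replicate k emptyᵀ) (elements x U)

  realised-sizedSumsOf : ∀ {n} k (x : Fin n → Z3^ r) U → RealisedLevels x U 1 (sizedSumsOf k x U)
  realised-sizedSumsOf {zero}  k x []            = realisedLevels-emptyᵀ k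
  realised-sizedSumsOf {suc n} k x (outside ∷ U) = realisedLevels-outside (realised-sizedSumsOf k (x ∘ suc) U)
  realised-sizedSumsOf {suc n} k x (inside ∷ U)  =
    realisedLevels-grow realised-isZero (realised-sizedSumsOf k (x ∘ suc) U)

  realisedLevels-𝟘 : ∀ {n} {x : Fin n → Z3^ r} {U m k} {ts : Vec (Table r) k} →
    RealisedLevels x U m ts → T (someContain𝟘 ts) →
    ∃[ S ] (S ⊆ U × m ≤ ∣ S ∣ × ∣ S ∣ < m + k × subsetSum x S ≡ 𝟘)
  realisedLevels-𝟘 {m = m} {suc k} (ρ ∷ levels) h with Equivalence.to T-∨ h
  ... | inj₁ t𝟘 with ρ .realise 𝟘 t𝟘
  ...   | S , S⊆U , refl , sum≡𝟘 = S , S⊆U , ≤-refl , m<m+n m (s≤s z≤n) , sum≡𝟘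
  realisedLevels-𝟘 {m = m} {suc k} (ρ ∷ levels) h | inj₂ ts𝟘 with realisedLevels-𝟘 levels ts𝟘
  ... | S , S⊆U , m<∣S∣ , ∣S∣<1+m+k , sum≡𝟘 =
    S , S⊆U , <⇒≤ m<∣S∣ , subst (∣ S ∣ <_) (sym (+-suc m k)) ∣S∣<1+m+k , sum≡𝟘

open Canonical _≟ᵛ_ (vectors 3) ∈-vectors (vectors-unique 3)

sumsAccumulator : Accumulator (Z3^ 3) (Table 3)
sumsAccumulator = record
  { step      = addToSums
  ; good      = λ s → lookupᵀ s 𝟘
  ; step-comm = addToSums-comm
  ; good-step = addToSums-𝟘
  }

sizedSumsAccumulator : Accumulator (Z3^ 3) (Vec (Table 3) 3)
sizedSumsAccumulator = record
  { step      = addToSizedSums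
  ; good      = someContain𝟘
  ; step-comm = λ a b → growLevels-comm a b isZero
  ; good-step = λ a → growLevels-someContain𝟘 a isZero
  }

sums-certificate : SubsetSearch.check sumsAccumulator emptyᵀ (vectors 3) 7 ≡ true
sums-certificate = refl

sizedSums-certificate : SubsetSearch.check sizedSumsAccumulator (replicate 3 emptyᵀ) (vectors 3) 10 ≡ true
sizedSums-certificate = refl

-- The implicit lists are given explicitly: leaving them to unification makes Agda unfold the
-- search on symbolic elements.
𝟘∈sumsOf : ∀ {n} {x : Fin n → Z3^ 3} → Distinct x → ∀ U → 7 ≤ ∣ U ∣ → T (lookupᵀ (sumsOf x U) 𝟘)
𝟘∈sumsOf {x = x} distinct U 7≤∣U∣ =
  SubsetSearch.check-sound-↭ sumsAccumulator emptyᵀ (vectors 3) 7 sums-certificate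
    {elements x U} {canonical (elements x U)}
    (↭-canonical (elements-unique distinct U)) (canonical⊑universe (elements x U))
    (subst (7 ≤_) (sym (length-elements x U)) 7≤∣U∣)

𝟘∈sizedSumsOf : ∀ {n} {x : Fin n → Z3^ 3} → Distinct x → ∀ U → 10 ≤ ∣ U ∣ →
                T (someContain𝟘 (sizedSumsOf 3 x U))
𝟘∈sizedSumsOf {x = x} distinct U 10≤∣U∣ =
  SubsetSearch.check-sound-↭ sizedSumsAccumulator (replicate 3 emptyᵀ) (vectors 3) 10
    sizedSums-certificate {elements x U} {canonical (elements x U)}
    (↭-canonical (elements-unique distinct U)) (canonical⊑universe (elements x U))
    (subst (10 ≤_) (sym (length-elements x U)) 10≤∣U∣)

zeroSumSubset : ∀ {n} (x : Fin n → Z3^ 3) → Distinct x → ∀ U → 7 ≤ ∣ U ∣ →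
                ∃[ S ] (S ⊆ U × Nonempty S × subsetSum x S ≡ 𝟘)
zeroSumSubset x distinct U 7≤∣U∣ =
  let S , S⊆U , 0<∣S∣ , sum≡𝟘 = realised-sumsOf x U .realise 𝟘 (𝟘∈sumsOf distinct U 7≤∣U∣)
  in S , S⊆U , ∣p∣>0⇒Nonempty S 0<∣S∣ , sum≡𝟘

shortZeroSumSubset : ∀ {n} (x : Fin n → Z3^ 3) → Distinct x → ∀ U → 10 ≤ ∣ U ∣ →
                     ∃[ S ] (S ⊆ U × Nonempty S × ∣ S ∣ ≤ 3 × subsetSum x S ≡ 𝟘)
shortZeroSumSubset x distinct U 10≤∣U∣ =
  let S , S⊆U , 0<∣S∣ , ∣S∣<4 , sum≡𝟘 =
        realisedLevels-𝟘 {ts = sizedSumsOf 3 x U} (realised-sizedSumsOf 3 x U) (𝟘∈sizedSumsOf distinct U 10≤∣U∣)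
  in S , S⊆U , ∣p∣>0⇒Nonempty S 0<∣S∣ , ≤-pred ∣S∣<4 , sum≡𝟘

DisjointZeroSumPair : ∀ {r n} → (Fin n → Z3^ r) → Set
DisjointZeroSumPair x =
  ∃[ A ] (Nonempty A × subsetSum x A ≡ 𝟘 × ∃[ B ] (Nonempty B × subsetSum x B ≡ 𝟘 × A ∩ B ≡ ⊥))

hasDisjointZeroSums₂⇔pair : ∀ {r n} (x : Fin n → Z3^ r) → HasDisjointZeroSums 2 x ⇔ DisjointZeroSumPair x
hasDisjointZeroSums₂⇔pair x = mk⇔
  (λ (S , nonempty , zeroSum , disjoint) →
    S zero , nonempty zero , zeroSum zero , S (suc zero) , nonempty (suc zero) , zeroSum (suc zero) ,
    disjoint zero (suc zero) λ ())
  λ (A , neA , sumA , B , neB , sumB , A∩B≡⊥) →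
    let S : Fin 2 → Subset _
        S = lookup (A ∷ B ∷ [])
    in S , (λ { zero → neA ; (suc zero) → neB }) , (λ { zero → sumA ; (suc zero) → sumB }) ,
       λ { zero zero 0≢0 → contradiction refl 0≢0
         ; zero (suc zero) _ → A∩B≡⊥
         ; (suc zero) zero _ → ≡-trans (∩-comm B A) A∩B≡⊥
         ; (suc zero) (suc zero) 1≢1 → contradiction refl 1≢1 }

-- Destructured through helper functions: with or let here would make Agda unfold the searches
-- on ten symbolic elements.
upperBound : Prop-D* 3 2 10
upperBound x distinct = fromShortSubset (shortZeroSumSubset x distinct ⊤ ≤-refl)
  where
  fromShortSubset : ∃[ A ] (A ⊆ ⊤ × Nonempty A × ∣ A ∣ ≤ 3 × subsetSum x A ≡ 𝟘) → HasDisjointZeroSums 2 x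
  fromShortSubset (A , _ , neA , ∣A∣≤3 , sumA) = fromSecondSubset (zeroSumSubset x distinct (∁ A) 7≤∣∁A∣)
    where
    7≤∣∁A∣ : 7 ≤ ∣ ∁ A ∣
    7≤∣∁A∣ = subst (7 ≤_) (sym (∣∁p∣≡n∸∣p∣ A)) (∸-monoʳ-≤ 10 ∣A∣≤3)
    fromSecondSubset : ∃[ B ] (B ⊆ ∁ A × Nonempty B × subsetSum x B ≡ 𝟘) → HasDisjointZeroSums 2 x
    fromSecondSubset (B , B⊆∁A , neB , sumB) =
      Equivalence.from (hasDisjointZeroSums₂⇔pair x) (A , neA , sumA , B , neB , sumB , ⊆∁⇒∩≡⊥ B⊆∁A)

Prop-D*-suc : ∀ {r k n} → Prop-D* r k n → Prop-D* r k (suc n)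
Prop-D*-suc P x distinct with P (x ∘ suc) (distinct-suc distinct)
... | S , nonempty , zeroSum , disjoint =
  (λ j → outside ∷ S j) ,
  (λ j → Product.map suc there (nonempty j)) ,
  (λ j → ≡-trans (⊕-identityˡ _) (zeroSum j)) ,
  (λ j j′ j≢j′ → cong (outside ∷_) (disjoint j j′ j≢j′))

Prop-D*-mono : ∀ {r k m n} → m ≤′ n → Prop-D* r k m → Prop-D* r k n
Prop-D*-mono (≤′-reflexive refl) = id
Prop-D*-mono (≤′-step m≤′n)      = Prop-D*-suc ∘ Prop-D*-mono m≤′n

distinct? : ∀ {r n} (x : Fin n → Z3^ r) → Dec (Distinct x)
distinct? x = Fin.all? λ i → Fin.all? λ j → (x i ≟ᵛ x j) →-dec (i Fin.≟ j)

disjointZeroSumPair? : ∀ {r n} (x : Fin n → Z3^ r) → Dec (DisjointZeroSumPair x)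
disjointZeroSumPair? x = anySubset? λ A → nonempty? A ×-dec (subsetSum x A ≟ᵛ 𝟘) ×-dec
  anySubset? λ B → nonempty? B ×-dec (subsetSum x B ≟ᵛ 𝟘) ×-dec ≡-dec Bool._≟_ (A ∩ B) ⊥

nineElements : Fin 9 → Z3^ 3
nineElements = lookup
  ( (# 0 ∷ # 2 ∷ # 0 ∷ []) ∷ (# 0 ∷ # 1 ∷ # 1 ∷ []) ∷ (# 1 ∷ # 2 ∷ # 2 ∷ [])
  ∷ (# 2 ∷ # 1 ∷ # 2 ∷ []) ∷ (# 0 ∷ # 0 ∷ # 1 ∷ []) ∷ (# 1 ∷ # 0 ∷ # 1 ∷ [])
  ∷ (# 2 ∷ # 0 ∷ # 1 ∷ []) ∷ (# 2 ∷ # 2 ∷ # 0 ∷ []) ∷ (# 2 ∷ # 2 ∷ # 2 ∷ []) ∷ [])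

lowerBound : ∀ m → m < 10 → ¬ Prop-D* 3 2 m
lowerBound m (s≤s m≤9) P =
  from-no (disjointZeroSumPair? nineElements)
    (Equivalence.to (hasDisjointZeroSums₂⇔pair nineElements)
      (Prop-D*-mono (≤⇒≤′ m≤9) P nineElements (from-yes (distinct? nineElements))))

mainTheorem4 : D*≡ 3 2 10
mainTheorem4 = upperBound , lowerBound
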